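{- Let $R$ be any one of the following sixteen subsets of $\{0,1,2,3\}^2$: (A1) $\{(0,0),(0,1),(0,2),(0,3),(1,1),(1,2),(3,1),(3,2)\}$; (A2) $\{(0,0),(1,0),(2,0),(3,0),(1,1),(2,1),(1,3),(2,3)\}$; (A3) $\{(0,1),(0,2),(2,1),(2,2),(3,0),(3,1),(3,2),(3,3)\}$; (A4) $\{(1,0),(1,2),(2,0),(2,2),(0,3),(1,3),(2,3),(3,3)\}$; (A5) $\{(0,0),(0,1),(0,2),(0,3),(2,1),(2,2),(3,1),(3,2)\}$; (A6) $\{(0,0),(1,0),(2,0),(3,0),(1,2),(2,2),(1,3),(2,3)\}$; (A7) $\{(0,1),(0,2),(1,1),(1,2),(3,0),(3,1),(3,2),(3,3)\}$; (A8) $\{(1,0),(1,1),(2,0),(2,1),(0,3),(1,3),(2,3),(3,3)\}$; (A9) $\{(0,1),(0,2),(0,3),(1,1),(2,1),(3,1),(3,2),(3,3)\}$; (A10) $\{(0,0),(0,1),(0,2),(1,2),(2,2),(3,0),(3,1),(3,2)\}$; (A11) $\{(0,0),(0,3),(1,0),(1,3),(2,0),(2,1),(2,2),(2,3)\}$; (A12) $\{(1,0),(1,1),(1,2),(1,3),(2,0),(2,3),(3,0),(3,3)\}$; (A13) $\{(0,0),(0,1),(0,2),(1,1),(2,1),(3,0),(3,1),(3,2)\}$; (A14) $\{(0,0),(0,3),(1,0),(1,1),(1,2),(1,3),(2,0),(2,3)\}$; (A15) $\{(0,1),(0,2),(0,3),(1,2),(2,2),(3,1),(3,2),(3,3)\}$;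 (A16) $\{(1,0),(2,0),(3,0),(2,1),(2,2),(1,3),(2,3),(3,3)\}$. Then the mesh patterns $(123,R)$ and $(321,R)$ are jointly equidistributed.
   Context: $S_n$ is the set of permutations of $\{1,\dots,n\}$. A mesh pattern of length $k$ is a pair $(\tau,R)$ with $\tau\in S_k$ and $R\subseteq\{0,\dots,k\}^2$; the element $(a,b)\in R$ is the "shaded box" whose corners are $(a,b),(a,b+1),(a+1,b+1),(a+1,b)$ in the plot of $\tau$ (first coordinate = position, second = value). An occurrence of $(\tau,R)$ in $\pi=\pi_1\cdots\pi_n\in S_n$ is a tuple of indices $i_1<\dots<i_k$ such that $\pi_{i_1}\cdots\pi_{i_k}$ is order-isomorphic to $\tau$ and, setting $i_0=0$, $i_{k+1}=n+1$, letting $v_1<\dots<v_k$ be the values $\pi_{i_1},\dots,\pi_{i_k}$ in increasing order and $v_0=0$, $v_{k+1}=n+1$, for every $(a,b)\in R$ there is no index $m$ with $i_a<m<i_{a+1}$ and $v_b<\pi_m<v_{b+1}$. The number of occurrences is the number of such index tuples. Two mesh patterns $q_1,q_2$ are jointly equidistributed if for all $n\ge 1$ and all integers $k,\ell\ge 0$, the number of $\pi\in S_n$ with exactly $k$ occurrences of $q_1$ and exactly $\ell$ occurrences of $q_2$ equals the number of $\pi\in S_n$ with exactly $\ell$ occurrences of $q_1$ and exactly $k$ occurrences of $q_2$. -}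

module Defs where

open import Data.Nat using (ℕ; zero; suc; _+_; _≡ᵇ_; _<ᵇ_)
open import Data.Nat.Properties using (≤-decTotalOrder)
open import Data.Bool using (Bool; true; false; _∧_; _∨_; not; if_then_else_)
open import Data.List using (List; []; _∷_; _++_; map; length; concatMap; foldr; upTo)
open import Data.Product using (_×_; _,_; proj₁; proj₂)
open import Relation.Binary.PropositionalEquality using (_≡_)
open import Data.List.Sort.InsertionSort.Base ≤-decTotalOrder using (sort)

count : {A : Set} → (A → Bool) → List A → ℕ
count p []       = 0
count p (x ∷ xs) = if p x then suc (count p xs) else count p xs

allB : {A : Set} → (A → Bool) → List A → Bool
allB p = foldr (λ x b → p x ∧ b) true

anyB : {A : Set} → (A → Bool) → List A → Bool
anyB p = foldr (λ x b → p x ∨ b) false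

-- 0-indexed lookup with default 0
at : List ℕ → ℕ → ℕ
at []       _       = 0
at (x ∷ xs) zero    = x
at (x ∷ xs) (suc i) = at xs i

oneTo : ℕ → List ℕ
oneTo n = map suc (upTo n)

choose : ℕ → List ℕ → List (List ℕ)
choose zero    _        = [] ∷ []
choose (suc k) []       = []
choose (suc k) (x ∷ xs) = map (x ∷_) (choose k xs) ++ choose (suc k) xs

tuples : ℕ → List ℕ → List (List ℕ)
tuples zero    xs = [] ∷ []
tuples (suc n) xs = concatMap (λ x → map (x ∷_) (tuples n xs)) xs

distinct : List ℕ → Bool
distinct []       = true
distinct (x ∷ xs) = not (anyB (x ≡ᵇ_) xs) ∧ distinct xs

-- Permutations: π ∈ S_n is the word π₁⋯πₙ, a list of length n with
-- distinct entries from {1,…,n}.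

Sn : ℕ → List (List ℕ)
Sn n = filterB (tuples n (oneTo n))
  where
  filterB : List (List ℕ) → List (List ℕ)
  filterB []       = []
  filterB (l ∷ ls) = if distinct l then l ∷ filterB ls else filterB ls

-- Mesh patterns (τ , R): τ is a permutation word of length k,
-- R a list of shaded boxes (a , b), 0 ≤ a, b ≤ k.

record MeshPattern : Set where
  constructor mesh
  field
    τ : List ℕ
    R : List (ℕ × ℕ)
open MeshPattern public

positions : List ℕ → List ℕ
positions xs = oneTo (length xs)

-- the subsequence π_{i_1} ⋯ π_{i_k} (π indexed from 1)
valuesAt : List ℕ → List ℕ → List ℕ
valuesAt π is = map (λ i → at π (i Data.Nat.∸ 1)) is

orderIso : List ℕ → List ℕ → Bool
orderIso σ τ =
  (length σ ≡ᵇ length τ) ∧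
  allB (λ a → allB (λ b →
    eqB (at σ (a Data.Nat.∸ 1) <ᵇ at σ (b Data.Nat.∸ 1))
        (at τ (a Data.Nat.∸ 1) <ᵇ at τ (b Data.Nat.∸ 1)))
    (positions τ)) (positions τ)
  where
  eqB : Bool → Bool → Bool
  eqB true  y = y
  eqB false y = not y

isOccurrence : MeshPattern → (π : List ℕ) → (is : List ℕ) → Bool
isOccurrence p π is =
  orderIso (valuesAt π is) (τ p) ∧ allB boxEmpty (R p)
  where
  n  = length π
  -- i₀ = 0, i₁, …, i_k, i_{k+1} = n+1   (0-indexed list)
  ext : List ℕ
  ext = 0 ∷ (is ++ (suc n ∷ []))
  -- v₀ = 0, v₁ < ⋯ < v_k (sorted values), v_{k+1} = n+1
  vext : List ℕ
  vext = 0 ∷ (sort (valuesAt π is) ++ (suc n ∷ []))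
  boxEmpty : ℕ × ℕ → Bool
  boxEmpty (a , b) =
    not (anyB (λ m → (at ext a <ᵇ m) ∧ (m <ᵇ at ext (suc a)) ∧
                      (at vext b <ᵇ at π (m Data.Nat.∸ 1)) ∧
                      (at π (m Data.Nat.∸ 1) <ᵇ at vext (suc b)))
              (oneTo n))

occ : MeshPattern → List ℕ → ℕ
occ p π = count (isOccurrence p π) (choose (length (τ p)) (oneTo (length π)))

jointCount : MeshPattern → MeshPattern → ℕ → ℕ → ℕ → ℕ
jointCount q₁ q₂ n k ℓ =
  count (λ π → (occ q₁ π ≡ᵇ k) ∧ (occ q₂ π ≡ᵇ ℓ)) (Sn n)

JointlyEquidistributed : MeshPattern → MeshPattern → Set
JointlyEquidistributed q₁ q₂ =
  ∀ (n k ℓ : ℕ) → 1 Data.Nat.≤ n → jointCount q₁ q₂ n k ℓ ≡ jointCount q₁ q₂ n ℓ k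

shadings : List (List (ℕ × ℕ))
shadings =
    ((0 , 0) ∷ (0 , 1) ∷ (0 , 2) ∷ (0 , 3) ∷ (1 , 1) ∷ (1 , 2) ∷ (3 , 1) ∷ (3 , 2) ∷ [])
  ∷ ((0 , 0) ∷ (1 , 0) ∷ (2 , 0) ∷ (3 , 0) ∷ (1 , 1) ∷ (2 , 1) ∷ (1 , 3) ∷ (2 , 3) ∷ [])
  ∷ ((0 , 1) ∷ (0 , 2) ∷ (2 , 1) ∷ (2 , 2) ∷ (3 , 0) ∷ (3 , 1) ∷ (3 , 2) ∷ (3 , 3) ∷ [])
  ∷ ((1 , 0) ∷ (1 , 2) ∷ (2 , 0) ∷ (2 , 2) ∷ (0 , 3) ∷ (1 , 3) ∷ (2 , 3) ∷ (3 , 3) ∷ [])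
  ∷ ((0 , 0) ∷ (0 , 1) ∷ (0 , 2) ∷ (0 , 3) ∷ (2 , 1) ∷ (2 , 2) ∷ (3 , 1) ∷ (3 , 2) ∷ [])
  ∷ ((0 , 0) ∷ (1 , 0) ∷ (2 , 0) ∷ (3 , 0) ∷ (1 , 2) ∷ (2 , 2) ∷ (1 , 3) ∷ (2 , 3) ∷ [])
  ∷ ((0 , 1) ∷ (0 , 2) ∷ (1 , 1) ∷ (1 , 2) ∷ (3 , 0) ∷ (3 , 1) ∷ (3 , 2) ∷ (3 , 3) ∷ [])
  ∷ ((1 , 0) ∷ (1 , 1) ∷ (2 , 0) ∷ (2 , 1) ∷ (0 , 3) ∷ (1 , 3) ∷ (2 , 3) ∷ (3 , 3) ∷ [])
  ∷ ((0 , 1) ∷ (0 , 2) ∷ (0 , 3) ∷ (1 , 1) ∷ (2 , 1) ∷ (3 , 1) ∷ (3 , 2) ∷ (3 , 3) ∷ [])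
  ∷ ((0 , 0) ∷ (0 , 1) ∷ (0 , 2) ∷ (1 , 2) ∷ (2 , 2) ∷ (3 , 0) ∷ (3 , 1) ∷ (3 , 2) ∷ [])
  ∷ ((0 , 0) ∷ (0 , 3) ∷ (1 , 0) ∷ (1 , 3) ∷ (2 , 0) ∷ (2 , 1) ∷ (2 , 2) ∷ (2 , 3) ∷ [])
  ∷ ((1 , 0) ∷ (1 , 1) ∷ (1 , 2) ∷ (1 , 3) ∷ (2 , 0) ∷ (2 , 3) ∷ (3 , 0) ∷ (3 , 3) ∷ [])
  ∷ ((0 , 0) ∷ (0 , 1) ∷ (0 , 2) ∷ (1 , 1) ∷ (2 , 1) ∷ (3 , 0) ∷ (3 , 1) ∷ (3 , 2) ∷ [])
  ∷ ((0 , 0) ∷ (0 , 3) ∷ (1 , 0) ∷ (1 , 1) ∷ (1 , 2) ∷ (1 , 3) ∷ (2 , 0) ∷ (2 , 3) ∷ [])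
  ∷ ((0 , 1) ∷ (0 , 2) ∷ (0 , 3) ∷ (1 , 2) ∷ (2 , 2) ∷ (3 , 1) ∷ (3 , 2) ∷ (3 , 3) ∷ [])
  ∷ ((1 , 0) ∷ (2 , 0) ∷ (3 , 0) ∷ (2 , 1) ∷ (2 , 2) ∷ (1 , 3) ∷ (2 , 3) ∷ (3 , 3) ∷ [])
  ∷ []

p123 : List ℕ
p123 = 1 ∷ 2 ∷ 3 ∷ []

p321 : List ℕ
p321 = 3 ∷ 2 ∷ 1 ∷ []

{-# OPTIONS --safe #-}
module Submission where

-- Reversal and complementation are involutions of S_n that turn occurrences of 123 into
-- occurrences of 321 and back, moving the shaded box (a, b) to (3 - a, b), respectively
-- (a, 3 - b). Each of the sixteen shadings is mapped to itself by one of these two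
-- reflections, so the corresponding involution exchanges the numbers of occurrences of
-- (123, R) and (321, R) in every permutation, which makes their joint distribution symmetric.

open import Defs
open import Data.Bool using (Bool; true; false; T; _∧_; _∨_; not; if_then_else_)
open import Data.Bool.Properties using (T-∧; T-∨; ∧-comm; ∧-commutativeMonoid)
open import Algebra.Bundles using (CommutativeMonoid)
open import Algebra.Properties.CommutativeSemigroup (CommutativeMonoid.commutativeSemigroup ∧-commutativeMonoid)
  using (x∙yz≈y∙xz)
open import Data.Empty using (⊥-elim)
open import Data.List
  using (List; []; _∷_; _++_; _∷ʳ_; map; length; reverse; concatMap; cartesianProductWith; filterᵇ; upTo)
open import Data.List.Membership.Propositional using (_∈_)
open import Data.List.Membership.Propositional.Properties
  using ( ∈-map⁺; ∈-map⁻; ∈-++⁻; ∈-upTo⁺; ∈-upTo⁻; ∈-∃++; ∈-filter⁺; ∈-filter⁻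
        ; ∈-cartesianProductWith⁺; ∈-cartesianProductWith⁻)
open import Data.List.Properties
  using ( map-∘; map-++; map-cong; map-cong-local; map-id-local; length-map; length-reverse; unfold-reverse
        ; reverse-map; reverse-involutive; reverse-++; upTo-∷ʳ; map-upTo; ∷-injective; ++-assoc)
open import Data.List.Relation.Unary.All as All using (All; []; _∷_)
import Data.List.Relation.Unary.All.Properties as AllP
import Data.List.Relation.Unary.AllPairs as AllPairs
open import Data.List.Relation.Unary.Any using (here; there)
open import Data.List.Relation.Unary.Unique.Propositional using (Unique; []; _∷_)
import Data.List.Relation.Unary.Unique.Propositional.Properties as Unique
open import Data.List.Relation.Binary.Permutation.Propositional as Perm
  using (_↭_; ↭-refl; ↭-prep; ↭-sym; ↭-trans; ↭⇒↭ₛ; module PermutationReasoning)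
import Data.List.Relation.Binary.Permutation.Propositional.Properties as ↭
import Data.List.Relation.Binary.Permutation.Setoid.Properties as ↭ₛ
open import Data.Nat using (ℕ; zero; suc; _∸_; _≤_; _<_; z≤n; s≤s; _<ᵇ_; _≡ᵇ_; _≤?_)
open import Data.Nat.Properties
  using ( ≤-decTotalOrder; <ᵇ⇒<; <⇒<ᵇ; ≡ᵇ⇒≡; ≡⇒≡ᵇ; <⇒≤; <⇒≱; <-trans; ≤-refl; n∸n≡0; m∸n≤m; m∸[m∸n]≡n
        ; m≤n⇒m≤1+n; m<n⇒0<n∸m; ∸-+-assoc; +-comm; ∸-monoʳ-<; ∸-cancelʳ-<; suc-injective; _≟_)
open import Data.List.Sort.InsertionSort.Base ≤-decTotalOrder using (sort)
open import Data.Product using (_×_; _,_; proj₁; proj₂; ∃; swap)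
import Data.Product.Properties as Product
open import Data.Sum using (_⊎_; inj₁; inj₂; [_,_])
open import Function using (_∘_)
open import Function.Bundles using (_⇔_; mk⇔; Equivalence)
import Function.Properties.Equivalence as ⇔
open import Data.Product.Function.NonDependent.Propositional using (_×-⇔_)
open import Relation.Binary.PropositionalEquality
  using (_≡_; refl; sym; trans; cong; cong₂; subst; setoid; module ≡-Reasoning)
open import Relation.Nullary using (¬_; Dec)
open import Relation.Nullary.Decidable using (T?; dec-true; dec-false; toWitness; _×-dec_; _⊎-dec_)
open import Data.List.Membership.DecPropositional (Product.≡-dec _≟_ _≟_) using (_∈?_)

open Equivalence using (to; from)

private
  variable
    A : Set
    m n : ℕ
    p q : A → Bool
    xs ys : List A

T-injective : ∀ {x y} → T x ⇔ T y → x ≡ y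
T-injective {false} {false} _   = refl
T-injective {false} {true}  x⇔y = ⊥-elim (from x⇔y _)
T-injective {true}  {false} x⇔y = ⊥-elim (to x⇔y _)
T-injective {true}  {true}  _   = refl

∧-cong-guarded : ∀ {x x′ y y′} → x ≡ x′ → (T x′ → y ≡ y′) → x ∧ y ≡ x′ ∧ y′
∧-cong-guarded {x′ = false} refl _ = refl
∧-cong-guarded {x′ = true}  refl h = h _

T-not : ∀ {x} → T (not x) ⇔ (¬ T x)
T-not {false} = mk⇔ (λ _ ()) _
T-not {true}  = mk⇔ (λ ()) (λ ¬t → ¬t _)

<ᵇ-true : m < n → (m <ᵇ n) ≡ true
<ᵇ-true m<n = T-injective (mk⇔ _ (λ _ → <⇒<ᵇ m<n))

<ᵇ-false : n ≤ m → (m <ᵇ n) ≡ false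
<ᵇ-false {n} {m} n≤m = T-injective (mk⇔ (λ m<n → <⇒≱ (<ᵇ⇒< m n m<n) n≤m) λ ())

n<ᵇn : ∀ n → (n <ᵇ n) ≡ false
n<ᵇn n = <ᵇ-false {n} ≤-refl

<ᵇ-cong : ∀ {m n m′ n′} → m < n ⇔ m′ < n′ → (m <ᵇ n) ≡ (m′ <ᵇ n′)
<ᵇ-cong {m} {n} {m′} {n′} h =
  T-injective (mk⇔ (<⇒<ᵇ ∘ to h ∘ <ᵇ⇒< m n) (<⇒<ᵇ ∘ from h ∘ <ᵇ⇒< m′ n′))

N∸m<N∸n⇔n<m : ∀ {N m n} → m ≤ N → N ∸ m < N ∸ n ⇔ n < m
N∸m<N∸n⇔n<m m≤N = mk⇔ ∸-cancelʳ-< (λ n<m → ∸-monoʳ-< n<m m≤N)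

allB-lookup : ∀ {x} → T (allB p xs) → x ∈ xs → T (p x)
allB-lookup {p = p} {xs = y ∷ _} t (here refl) = proj₁ (to (T-∧ {p y}) t)
allB-lookup {p = p} {xs = y ∷ _} t (there x∈) = allB-lookup (proj₂ (to (T-∧ {p y}) t)) x∈

allB-tabulate : (∀ {x} → x ∈ xs → T (p x)) → T (allB p xs)
allB-tabulate {xs = []}    _ = _
allB-tabulate {xs = y ∷ _} {p = p} h = from (T-∧ {p y}) (h (here refl) , allB-tabulate (h ∘ there))

anyB-witness : T (anyB p xs) → ∃ λ x → x ∈ xs × T (p x)
anyB-witness {p = p} {xs = y ∷ _} t with to (T-∨ {p y}) t
... | inj₁ py = y , here refl , py
... | inj₂ t′ = let x , x∈ , px = anyB-witness t′ in x , there x∈ , px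

anyB-intro : ∀ {x} → x ∈ xs → T (p x) → T (anyB p xs)
anyB-intro {xs = y ∷ _} {p = p} (here refl) px = from (T-∨ {p y}) (inj₁ px)
anyB-intro {xs = y ∷ _} {p = p} (there x∈) px = from (T-∨ {p y}) (inj₂ (anyB-intro x∈ px))

allB-cong : (∀ {x} → x ∈ xs → p x ≡ q x) → allB p xs ≡ allB q xs
allB-cong {xs = []}    _ = refl
allB-cong {xs = _ ∷ _} h = cong₂ _∧_ (h (here refl)) (allB-cong (h ∘ there))

anyB-cong : (∀ {x} → x ∈ xs → p x ≡ q x) → anyB p xs ≡ anyB q xs
anyB-cong {xs = []}    _ = refl
anyB-cong {xs = _ ∷ _} h = cong₂ _∨_ (h (here refl)) (anyB-cong (h ∘ there))

count-cong : (∀ {x} → x ∈ xs → p x ≡ q x) → count p xs ≡ count q xs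
count-cong {xs = []}    _ = refl
count-cong {xs = x ∷ _} {p = p} {q = q} h
  rewrite h (here refl) | count-cong {p = p} {q} (h ∘ there) = refl

count-map : ∀ (f : A → A) xs → count p (map f xs) ≡ count (p ∘ f) xs
count-map f []       = refl
count-map {p = p} f (x ∷ xs) rewrite count-map {p = p} f xs = refl

count-↭ : xs ↭ ys → count p xs ≡ count p ys
count-↭ Perm.refl = refl
count-↭ {p = p} (Perm.prep x xs↭ys) rewrite count-↭ {p = p} xs↭ys = refl
count-↭ {p = p} (Perm.swap x y xs↭ys) with p x | p y
... | true  | true  = cong (suc ∘ suc) (count-↭ xs↭ys)
... | true  | false = cong suc (count-↭ xs↭ys)
... | false | true  = cong suc (count-↭ xs↭ys)
... | false | false = count-↭ xs↭ys
count-↭ (Perm.trans xs↭ys ys↭zs) = trans (count-↭ xs↭ys) (count-↭ ys↭zs)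

-- Involutions of a list

record InvolutionOn {A : Set} (g : A → A) (xs : List A) : Set where
  field
    closed     : ∀ {x} → x ∈ xs → g x ∈ xs
    involutive : ∀ {x} → x ∈ xs → g (g x) ≡ x

  injective : ∀ {x y} → x ∈ xs → y ∈ xs → g x ≡ g y → x ≡ y
  injective x∈ y∈ gx≡gy = trans (sym (involutive x∈)) (trans (cong g gx≡gy) (involutive y∈))

open InvolutionOn

allB-reindex : ∀ {g} → InvolutionOn g xs → allB p xs ≡ allB (p ∘ g) xs
allB-reindex {p = p} inv = T-injective (mk⇔
  (λ t → allB-tabulate (λ x∈ → allB-lookup t (closed inv x∈)))
  (λ t → allB-tabulate (λ x∈ → subst (T ∘ p) (involutive inv x∈) (allB-lookup t (closed inv x∈)))))

anyB-reindex : ∀ {g} → InvolutionOn g xs → anyB p xs ≡ anyB (p ∘ g) xs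
anyB-reindex {p = p} inv = T-injective (mk⇔
  (λ t → let _ , x∈ , px = anyB-witness t in
         anyB-intro (closed inv x∈) (subst (T ∘ p) (sym (involutive inv x∈)) px))
  (λ t → let _ , x∈ , pgx = anyB-witness t in anyB-intro (closed inv x∈) pgx))

Unique-resp-↭ : xs ↭ ys → Unique xs → Unique ys
Unique-resp-↭ xs↭ys = ↭ₛ.Unique-resp-↭ (setoid _) (↭⇒↭ₛ xs↭ys)

Unique-map-on : ∀ {f : A → A} → (∀ {x y} → x ∈ xs → y ∈ xs → f x ≡ f y → x ≡ y) →
                Unique xs → Unique (map f xs)
Unique-map-on inj [] = []
Unique-map-on inj (x≢xs ∷ u) =
  AllP.map⁺ (All.tabulate (λ y∈ fx≡fy → All.lookup x≢xs y∈ (inj (here refl) (there y∈) fx≡fy)))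
  ∷ Unique-map-on (λ x∈ y∈ → inj (there x∈) (there y∈)) u

Unique-same-members⇒↭ : Unique xs → Unique ys →
                        (∀ {z} → z ∈ xs → z ∈ ys) → (∀ {z} → z ∈ ys → z ∈ xs) → xs ↭ ys
Unique-same-members⇒↭ {xs = []} {ys = []}    _ _ _ _ = ↭-refl
Unique-same-members⇒↭ {xs = []} {ys = _ ∷ _} _ _ _ ys⊆xs with () ← ys⊆xs (here refl)
Unique-same-members⇒↭ {xs = x ∷ xs} (x≢xs ∷ u) u-ys xs⊆ys ys⊆xs
  with as , bs , refl ← ∈-∃++ (xs⊆ys (here refl)) =
  ↭-trans (↭-prep x (Unique-same-members⇒↭ u u-rest sub sup)) (↭-sym shift)
  where
  shift = ↭.shift x as bs
  u-x∷rest : Unique (x ∷ as ++ bs)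
  u-x∷rest = Unique-resp-↭ shift u-ys
  x≢rest = AllPairs.head u-x∷rest
  u-rest = AllPairs.tail u-x∷rest
  sub : ∀ {z} → z ∈ xs → z ∈ as ++ bs
  sub z∈ with ↭.∈-resp-↭ shift (xs⊆ys (there z∈))
  ... | here refl  = ⊥-elim (All.lookup x≢xs z∈ refl)
  ... | there z∈′ = z∈′
  sup : ∀ {z} → z ∈ as ++ bs → z ∈ xs
  sup z∈ with ys⊆xs (↭.∈-resp-↭ (↭-sym shift) (there z∈))
  ... | here refl  = ⊥-elim (All.lookup x≢rest z∈ refl)
  ... | there z∈′ = z∈′

map-involution-↭ : ∀ {g} → Unique xs → InvolutionOn g xs → map g xs ↭ xs
map-involution-↭ {xs = xs} {g = g} u inv =
  Unique-same-members⇒↭ (Unique-map-on (injective inv) u) u image⊆ ⊆image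
  where
  image⊆ : ∀ {z} → z ∈ map g xs → z ∈ xs
  image⊆ z∈ with _ , x∈ , refl ← ∈-map⁻ g z∈ = closed inv x∈
  ⊆image : ∀ {z} → z ∈ xs → z ∈ map g xs
  ⊆image z∈ = subst (_∈ map g xs) (involutive inv z∈) (∈-map⁺ g (closed inv z∈))

count-reindex : ∀ {g} → Unique xs → InvolutionOn g xs → count p xs ≡ count (p ∘ g) xs
count-reindex {xs = xs} {p = p} {g} u inv =
  trans (sym (count-↭ (map-involution-↭ u inv))) (count-map {p = p} g xs)

∈-oneTo⁻ : m ∈ oneTo n → 0 < m × m ≤ n
∈-oneTo⁻ m∈ with _ , t∈ , refl ← ∈-map⁻ suc m∈ = s≤s z≤n , ∈-upTo⁻ t∈

∈-oneTo⁺ : 0 < m → m ≤ n → m ∈ oneTo n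
∈-oneTo⁺ {suc _} _ m≤n = ∈-map⁺ suc (∈-upTo⁺ m≤n)

∈-oneTo⇒pred< : m ∈ oneTo n → m ∸ 1 < n
∈-oneTo⇒pred< m∈ with _ , t∈ , refl ← ∈-map⁻ suc m∈ = ∈-upTo⁻ t∈

∈-oneTo⇒≤suc : m ∈ oneTo n → m ≤ suc n
∈-oneTo⇒≤suc = m≤n⇒m≤1+n ∘ proj₂ ∘ ∈-oneTo⁻

oneTo-unique : ∀ n → Unique (oneTo n)
oneTo-unique n = Unique.map⁺ suc-injective (Unique.upTo⁺ n)

oneTo-suc : ∀ n → oneTo (suc n) ≡ 1 ∷ map suc (oneTo n)
oneTo-suc n = cong (λ l → 1 ∷ map suc l) (sym (map-upTo suc n))

oneTo-∷ʳ : ∀ n → oneTo (suc n) ≡ oneTo n ∷ʳ suc n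
oneTo-∷ʳ n = trans (cong (map suc) (sym (upTo-∷ʳ n))) (map-++ suc (upTo n) (n ∷ []))

mirror : ℕ → ℕ → ℕ
mirror n m = suc n ∸ m

mirror-involutive : m ≤ suc n → mirror n (mirror n m) ≡ m
mirror-involutive = m∸[m∸n]≡n

mirror-closed : m ∈ oneTo n → mirror n m ∈ oneTo n
mirror-closed {n = n} m∈ with t , t∈ , refl ← ∈-map⁻ suc m∈ =
  ∈-oneTo⁺ (m<n⇒0<n∸m (∈-upTo⁻ t∈)) (m∸n≤m n t)

mirror-involution : ∀ n → InvolutionOn (mirror n) (oneTo n)
mirror-involution n = record
  { closed     = mirror-closed
  ; involutive = mirror-involutive ∘ ∈-oneTo⇒≤suc
  }

mirror-<ᵇ : ∀ {m′} → m ≤ suc n → (mirror n m <ᵇ mirror n m′) ≡ (m′ <ᵇ m)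
mirror-<ᵇ m≤ = <ᵇ-cong (N∸m<N∸n⇔n<m m≤)

map-mirror-oneTo : ∀ n → map (mirror n) (oneTo n) ≡ reverse (oneTo n)
map-mirror-oneTo zero    = refl
map-mirror-oneTo (suc n) = begin
  map (mirror (suc n)) (oneTo (suc n))            ≡⟨ cong (map (mirror (suc n))) (oneTo-suc n) ⟩
  suc n ∷ map (mirror (suc n)) (map suc (oneTo n)) ≡⟨ cong (suc n ∷_) (sym (map-∘ (oneTo n))) ⟩
  suc n ∷ map (mirror n) (oneTo n)                ≡⟨ cong (suc n ∷_) (map-mirror-oneTo n) ⟩
  suc n ∷ reverse (oneTo n)                       ≡⟨ sym (reverse-++ (oneTo n) (suc n ∷ [])) ⟩
  reverse (oneTo n ∷ʳ suc n)                      ≡⟨ cong reverse (oneTo-∷ʳ n) ⟨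
  reverse (oneTo (suc n))                         ∎
  where open ≡-Reasoning

at-map : ∀ (f : ℕ → ℕ) {π t} → t < length π → at (map f π) t ≡ f (at π t)
at-map f {_ ∷ _} {zero}  _        = refl
at-map f {_ ∷ π} {suc _} (s≤s t<) = at-map f {π} t<

at-∈ : ∀ {π t} → t < length π → at π t ∈ π
at-∈ {_ ∷ _} {zero}  _        = here refl
at-∈ {_ ∷ π} {suc _} (s≤s t<) = there (at-∈ {π} t<)

at-++ˡ : ∀ ys {zs t} → t < length ys → at (ys ++ zs) t ≡ at ys t
at-++ˡ (_ ∷ _)  {t = zero}  _        = refl
at-++ˡ (_ ∷ ys) {t = suc _} (s≤s t<) = at-++ˡ ys t<

at-++-length : ∀ ys {x zs} → at (ys ++ x ∷ zs) (length ys) ≡ x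
at-++-length []       = refl
at-++-length (_ ∷ ys) = at-++-length ys

at-reverse : ∀ π {t} → t < length π → at (reverse π) (length π ∸ suc t) ≡ at π t
at-reverse (x ∷ π) {zero} _ = begin
  at (reverse (x ∷ π)) (length π)            ≡⟨ cong (λ l → at l (length π)) (unfold-reverse x π) ⟩
  at (reverse π ∷ʳ x) (length π)             ≡⟨ cong (at (reverse π ∷ʳ x)) (length-reverse π) ⟨
  at (reverse π ∷ʳ x) (length (reverse π))   ≡⟨ at-++-length (reverse π) ⟩
  x                                          ∎
  where open ≡-Reasoning
at-reverse (x ∷ π) {suc t} (s≤s t<) = begin
  at (reverse (x ∷ π)) (length π ∸ suc t)    ≡⟨ cong (λ l → at l (length π ∸ suc t)) (unfold-reverse x π) ⟩
  at (reverse π ∷ʳ x) (length π ∸ suc t)     ≡⟨ at-++ˡ (reverse π) index< ⟩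
  at (reverse π) (length π ∸ suc t)          ≡⟨ at-reverse π t< ⟩
  at π t                                     ∎
  where
  open ≡-Reasoning
  index< : length π ∸ suc t < length (reverse π)
  index< = subst (length π ∸ suc t <_) (sym (length-reverse π)) (∸-monoʳ-< (s≤s z≤n) t<)

at-reverse-mirror : ∀ {π} → length π ≡ n → m ∈ oneTo n → at (reverse π) (mirror n m ∸ 1) ≡ at π (m ∸ 1)
at-reverse-mirror {π = π} refl m∈ with t , t∈ , refl ← ∈-map⁻ suc m∈ =
  trans (cong (at (reverse π)) (trans (∸-+-assoc (length π) t 1) (cong (length π ∸_) (+-comm t 1))))
        (at-reverse π (∈-upTo⁻ t∈))

T-distinct⇔Unique : ∀ xs → T (distinct xs) ⇔ Unique xs
T-distinct⇔Unique []       = mk⇔ (λ _ → []) _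
T-distinct⇔Unique (x ∷ xs) = mk⇔
  (λ t → let fresh , rest = to T-∧ t in
         All.tabulate (λ y∈ x≡y → to T-not fresh (anyB-intro y∈ (≡⇒≡ᵇ x _ x≡y)))
         ∷ to (T-distinct⇔Unique xs) rest)
  (λ { (x≢xs ∷ u) → from T-∧
         ( from T-not (λ t → let y , y∈ , x≡ᵇy = anyB-witness t in All.lookup x≢xs y∈ (≡ᵇ⇒≡ x y x≡ᵇy))
         , from (T-distinct⇔Unique xs) u ) })

concatMap≡cartesianProductWith : ∀ {B C : Set} (f : A → B → C) xs ys →
  concatMap (λ x → map (f x) ys) xs ≡ cartesianProductWith f xs ys
concatMap≡cartesianProductWith f []       ys = refl
concatMap≡cartesianProductWith f (x ∷ xs) ys = cong (map (f x) ys ++_) (concatMap≡cartesianProductWith f xs ys)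

tuples-suc : ∀ n xs → tuples (suc n) xs ≡ cartesianProductWith _∷_ xs (tuples n xs)
tuples-suc n xs = concatMap≡cartesianProductWith _∷_ xs (tuples n xs)

∈-tuples⁻ : ∀ n {l} → l ∈ tuples n xs → length l ≡ n × All (_∈ xs) l
∈-tuples⁻ zero (here refl) = refl , []
∈-tuples⁻ {xs = xs} (suc n) l∈
  with _ , _ , x∈ , t∈ , refl ←
         ∈-cartesianProductWith⁻ _∷_ xs (tuples n xs) (subst (_ ∈_) (tuples-suc n xs) l∈) =
  let length≡ , entries = ∈-tuples⁻ n t∈ in cong suc length≡ , x∈ ∷ entries

∈-tuples⁺ : ∀ {l} → All (_∈ xs) l → l ∈ tuples (length l) xs
∈-tuples⁺ [] = here refl
∈-tuples⁺ {xs = xs} {x ∷ l} (x∈ ∷ entries)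
  rewrite tuples-suc (length l) xs =
  ∈-cartesianProductWith⁺ _∷_ x∈ (∈-tuples⁺ entries)

tuples-unique : ∀ n → Unique xs → Unique (tuples n xs)
tuples-unique zero _ = [] ∷ []
tuples-unique {xs = xs} (suc n) u
  rewrite tuples-suc n xs =
  Unique.cartesianProductWith⁺ _∷_ ∷-injective u (tuples-unique n u)

filterᵇ-characterisation : (F : List A → List A) → F [] ≡ [] →
  (∀ x xs → F (x ∷ xs) ≡ (if p x then x ∷ F xs else F xs)) → ∀ xs → F xs ≡ filterᵇ p xs
filterᵇ-characterisation F F[] F∷ []       = F[]
filterᵇ-characterisation {p = p} F F[] F∷ (x ∷ xs)
  rewrite F∷ x xs | filterᵇ-characterisation F F[] F∷ xs with p x
... | true  = refl
... | false = refl

Sn≡filterᵇ : ∀ n → Sn n ≡ filterᵇ distinct (tuples n (oneTo n))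
Sn≡filterᵇ n = trans unfold (filterᵇ-characterisation F refl (λ _ _ → refl) (tuples n (oneTo n)))
  where
  -- F is the filter local to the definition of Sn, which cannot be named;
  -- unification finds it once its argument is abstracted in unfold.
  F : List (List ℕ) → List (List ℕ)
  F = _
  unfold : Sn n ≡ F (tuples n (oneTo n))
  unfold with tuples n (oneTo n)
  ... | ts = refl

record IsPermutation (n : ℕ) (π : List ℕ) : Set where
  field
    length≡ : length π ≡ n
    entries : All (_∈ oneTo n) π
    unique  : Unique π

open IsPermutation

∈-Sn⇔IsPermutation : ∀ n {π} → π ∈ Sn n ⇔ IsPermutation n π
∈-Sn⇔IsPermutation n {π} rewrite Sn≡filterᵇ n = mk⇔
  (λ π∈ → let π∈tuples , d = ∈-filter⁻ (T? ∘ distinct) π∈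
              length≡ , entries = ∈-tuples⁻ n π∈tuples
          in record { length≡ = length≡ ; entries = entries ; unique = to (T-distinct⇔Unique π) d })
  (λ isPerm → ∈-filter⁺ (T? ∘ distinct)
     (subst (λ k → π ∈ tuples k (oneTo n)) (length≡ isPerm) (∈-tuples⁺ (entries isPerm)))
     (from (T-distinct⇔Unique π) (unique isPerm)))

Sn-unique : ∀ n → Unique (Sn n)
Sn-unique n rewrite Sn≡filterᵇ n = Unique.filter⁺ (T? ∘ distinct) (tuples-unique n (oneTo-unique n))

at-index< : ∀ {π : List ℕ} → length π ≡ n → m ∈ oneTo n → m ∸ 1 < length π
at-index< refl = ∈-oneTo⇒pred<

at-entry : ∀ {π : List ℕ} → IsPermutation n π → m ∈ oneTo n → at π (m ∸ 1) ∈ oneTo n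
at-entry {π = π} perm m∈ = All.lookup (entries perm) (at-∈ (at-index< {π = π} (length≡ perm) m∈))

IsPermutation-map : ∀ {g π} → InvolutionOn g (oneTo n) → IsPermutation n π → IsPermutation n (map g π)
IsPermutation-map {g = g} {π} inv perm = record
  { length≡ = trans (length-map g π) (length≡ perm)
  ; entries = AllP.map⁺ (All.map (closed inv) (entries perm))
  ; unique  = Unique-map-on (λ x∈ y∈ → injective inv (All.lookup (entries perm) x∈)
                                                       (All.lookup (entries perm) y∈))
                            (unique perm)
  }

IsPermutation-reverse : ∀ {π} → IsPermutation n π → IsPermutation n (reverse π)
IsPermutation-reverse {π = π} perm = record
  { length≡ = trans (length-reverse π) (length≡ perm)
  ; entries = ↭.All-resp-↭ π↭reverse (entries perm)
  ; unique  = Unique-resp-↭ π↭reverse (unique perm)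
  }
  where
  π↭reverse = ↭-sym (↭.↭-reverse π)

map-involution-Sn : ∀ {g} → InvolutionOn g (oneTo n) → InvolutionOn (map g) (Sn n)
map-involution-Sn {n} inv = record
  { closed     = from (∈-Sn⇔IsPermutation n) ∘ IsPermutation-map inv ∘ to (∈-Sn⇔IsPermutation n)
  ; involutive = λ π∈ → trans (sym (map-∘ _))
      (map-id-local (All.map (involutive inv) (entries (to (∈-Sn⇔IsPermutation n) π∈))))
  }

reverse-involution-Sn : ∀ n → InvolutionOn reverse (Sn n)
reverse-involution-Sn n = record
  { closed     = from (∈-Sn⇔IsPermutation n) ∘ IsPermutation-reverse ∘ to (∈-Sn⇔IsPermutation n)
  ; involutive = λ {π} _ → reverse-involutive π
  }

record OccurrenceSwap (q₁ q₂ : MeshPattern) (n : ℕ) : Set where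
  field
    symmetry   : List ℕ → List ℕ
    involution : InvolutionOn symmetry (Sn n)
    exchanges  : ∀ {π} → π ∈ Sn n → occ q₁ (symmetry π) ≡ occ q₂ π

jointlyEquidistributed : ∀ {q₁ q₂} → (∀ n → OccurrenceSwap q₁ q₂ n) → JointlyEquidistributed q₁ q₂
jointlyEquidistributed {q₁} {q₂} swaps n k ℓ _ = begin
  count (jointly k ℓ) (Sn n)             ≡⟨ count-reindex (Sn-unique n) involution ⟩
  count (jointly k ℓ ∘ symmetry) (Sn n)  ≡⟨ count-cong pointwise ⟩
  count (jointly ℓ k) (Sn n)             ∎
  where
  open ≡-Reasoning
  open OccurrenceSwap (swaps n)
  jointly : ℕ → ℕ → List ℕ → Bool
  jointly k ℓ π = (occ q₁ π ≡ᵇ k) ∧ (occ q₂ π ≡ᵇ ℓ)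
  pointwise : ∀ {π} → π ∈ Sn n → jointly k ℓ (symmetry π) ≡ jointly ℓ k π
  pointwise {π} π∈ = begin
    (occ q₁ (symmetry π) ≡ᵇ k) ∧ (occ q₂ (symmetry π) ≡ᵇ ℓ)
      ≡⟨ cong₂ (λ a b → (a ≡ᵇ k) ∧ (b ≡ᵇ ℓ)) (exchanges π∈) occ₂-symmetry ⟩
    (occ q₂ π ≡ᵇ k) ∧ (occ q₁ π ≡ᵇ ℓ)
      ≡⟨ ∧-comm (occ q₂ π ≡ᵇ k) _ ⟩
    (occ q₁ π ≡ᵇ ℓ) ∧ (occ q₂ π ≡ᵇ k)
      ∎
    where
    occ₂-symmetry : occ q₂ (symmetry π) ≡ occ q₁ π
    occ₂-symmetry = trans (sym (exchanges (closed involution π∈))) (cong (occ q₁) (involutive involution π∈))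

choose-map : ∀ k (f : ℕ → ℕ) xs → choose k (map f xs) ≡ map (map f) (choose k xs)
choose-map zero    f xs       = refl
choose-map (suc k) f []       = refl
choose-map (suc k) f (x ∷ xs) = begin
  map (f x ∷_) (choose k (map f xs)) ++ choose (suc k) (map f xs)
    ≡⟨ cong₂ _++_ (cong (map (f x ∷_)) (choose-map k f xs)) (choose-map (suc k) f xs) ⟩
  map (f x ∷_) (map (map f) (choose k xs)) ++ map (map f) (choose (suc k) xs)
    ≡⟨ cong (_++ _) (trans (sym (map-∘ (choose k xs))) (map-∘ (choose k xs))) ⟩
  map (map f) (map (x ∷_) (choose k xs)) ++ map (map f) (choose (suc k) xs)
    ≡⟨ map-++ (map f) (map (x ∷_) (choose k xs)) (choose (suc k) xs) ⟨
  map (map f) (choose (suc k) (x ∷ xs))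
    ∎
  where open ≡-Reasoning

∈-choose⁻ : ∀ k {xs l} → l ∈ choose k xs → length l ≡ k × All (_∈ xs) l
∈-choose⁻ zero    (here refl) = refl , []
∈-choose⁻ (suc k) {x ∷ xs} l∈ with ∈-++⁻ (map (x ∷_) (choose k xs)) l∈
... | inj₁ l∈′ with _ , t∈ , refl ← ∈-map⁻ (x ∷_) l∈′ =
  let length≡ , entries = ∈-choose⁻ k t∈ in cong suc length≡ , here refl ∷ All.map there entries
... | inj₂ l∈′ = let length≡ , entries = ∈-choose⁻ (suc k) l∈′ in length≡ , All.map there entries

choose-∷ʳ : ∀ k xs y → choose (suc k) (xs ∷ʳ y) ↭ choose (suc k) xs ++ map (_∷ʳ y) (choose k xs)
choose-∷ʳ zero    []       y = ↭-refl
choose-∷ʳ (suc k) []       y = ↭-refl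
choose-∷ʳ zero    (x ∷ xs) y = ↭-prep (x ∷ []) (choose-∷ʳ zero xs y)
choose-∷ʳ (suc k) (x ∷ xs) y = begin
  map (x ∷_) (choose (suc k) (xs ∷ʳ y)) ++ choose (suc (suc k)) (xs ∷ʳ y)
    ↭⟨ ↭.++⁺ (↭.map⁺ (x ∷_) (choose-∷ʳ k xs y)) (choose-∷ʳ (suc k) xs y) ⟩
  map (x ∷_) (C₁ ++ map (_∷ʳ y) C₀) ++ (C₂ ++ map (_∷ʳ y) C₁)
    ≡⟨ trans (cong (_++ (C₂ ++ map (_∷ʳ y) C₁)) (map-++ (x ∷_) C₁ (map (_∷ʳ y) C₀)))
             (++-assoc (map (x ∷_) C₁) _ _) ⟩
  map (x ∷_) C₁ ++ (map (x ∷_) (map (_∷ʳ y) C₀) ++ (C₂ ++ map (_∷ʳ y) C₁))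
    ↭⟨ ↭.++⁺ˡ (map (x ∷_) C₁) (↭.shifts (map (x ∷_) (map (_∷ʳ y) C₀)) C₂) ⟩
  map (x ∷_) C₁ ++ (C₂ ++ (map (x ∷_) (map (_∷ʳ y) C₀) ++ map (_∷ʳ y) C₁))
    ≡⟨ cong (λ l → map (x ∷_) C₁ ++ (C₂ ++ (l ++ map (_∷ʳ y) C₁))) (trans (sym (map-∘ C₀)) (map-∘ C₀)) ⟩
  map (x ∷_) C₁ ++ (C₂ ++ (map (_∷ʳ y) (map (x ∷_) C₀) ++ map (_∷ʳ y) C₁))
    ≡⟨ trans (cong (λ l → map (x ∷_) C₁ ++ (C₂ ++ l)) (sym (map-++ (_∷ʳ y) (map (x ∷_) C₀) C₁)))
             (sym (++-assoc (map (x ∷_) C₁) C₂ _)) ⟩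
  choose (suc (suc k)) (x ∷ xs) ++ map (_∷ʳ y) (choose (suc k) (x ∷ xs))
    ∎
  where
  open PermutationReasoning
  C₀ = choose k xs
  C₁ = choose (suc k) xs
  C₂ = choose (suc (suc k)) xs

choose-reverse : ∀ k xs → choose k (reverse xs) ↭ map reverse (choose k xs)
choose-reverse zero    xs       = ↭-refl
choose-reverse (suc k) []       = ↭-refl
choose-reverse (suc k) (x ∷ xs) = begin
  choose (suc k) (reverse (x ∷ xs))
    ≡⟨ cong (choose (suc k)) (unfold-reverse x xs) ⟩
  choose (suc k) (reverse xs ∷ʳ x)
    ↭⟨ choose-∷ʳ k (reverse xs) x ⟩
  choose (suc k) (reverse xs) ++ map (_∷ʳ x) (choose k (reverse xs))
    ↭⟨ ↭.++⁺ (choose-reverse (suc k) xs) (↭.map⁺ (_∷ʳ x) (choose-reverse k xs)) ⟩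
  map reverse (choose (suc k) xs) ++ map (_∷ʳ x) (map reverse (choose k xs))
    ↭⟨ ↭.++-comm (map reverse (choose (suc k) xs)) _ ⟩
  map (_∷ʳ x) (map reverse (choose k xs)) ++ map reverse (choose (suc k) xs)
    ≡⟨ cong (_++ _) (trans (sym (map-∘ (choose k xs)))
                    (trans (map-cong (sym ∘ unfold-reverse x) (choose k xs)) (map-∘ (choose k xs)))) ⟩
  map reverse (map (x ∷_) (choose k xs)) ++ map reverse (choose (suc k) xs)
    ≡⟨ map-++ reverse (map (x ∷_) (choose k xs)) (choose (suc k) xs) ⟨
  map reverse (choose (suc k) (x ∷ xs))
    ∎
  where open PermutationReasoning

choose-oneTo-mirror : ∀ k n → map (reverse ∘ map (mirror n)) (choose k (oneTo n)) ↭ choose k (oneTo n)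
choose-oneTo-mirror k n = begin
  map (reverse ∘ map (mirror n)) (choose k (oneTo n))
    ≡⟨ map-∘ (choose k (oneTo n)) ⟩
  map reverse (map (map (mirror n)) (choose k (oneTo n)))
    ≡⟨ cong (map reverse) (choose-map k (mirror n) (oneTo n)) ⟨
  map reverse (choose k (map (mirror n) (oneTo n)))
    ≡⟨ cong (map reverse ∘ choose k) (map-mirror-oneTo n) ⟩
  map reverse (choose k (reverse (oneTo n)))
    ↭⟨ ↭.map⁺ reverse (choose-reverse k (oneTo n)) ⟩
  map reverse (map reverse (choose k (oneTo n)))
    ≡⟨ trans (sym (map-∘ (choose k (oneTo n)))) (map-id-local (All.tabulate (λ {l} _ → reverse-involutive l))) ⟩
  choose k (oneTo n)
    ∎
  where open PermutationReasoning

-- Occurrences of patterns of length three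

-- orderIso unfolds to a conjunction of nine comparisons; fixing the Booleans that precede
-- the two we need makes every other case of the conjunction compute to false.
orderIso-123 : ∀ {x y z} → T (orderIso (x ∷ y ∷ z ∷ []) p123) ⇔ (x < y × y < z)
orderIso-123 {x} {y} {z} = mk⇔ to′ from′
  where
  to′ : T (orderIso (x ∷ y ∷ z ∷ []) p123) → x < y × y < z
  to′ t with x <ᵇ x | n<ᵇn x | x <ᵇ y in x<y | x <ᵇ z | y <ᵇ x | y <ᵇ y | n<ᵇn y | y <ᵇ z in y<z
  ... | _ | refl | true | true | false | _ | refl | true =
    <ᵇ⇒< x y (subst T (sym x<y) _) , <ᵇ⇒< y z (subst T (sym y<z) _)
  from′ : x < y × y < z → T (orderIso (x ∷ y ∷ z ∷ []) p123)
  from′ (x<y , y<z)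
    rewrite <ᵇ-true x<y | <ᵇ-true y<z | <ᵇ-true (<-trans x<y y<z)
          | <ᵇ-false (<⇒≤ x<y) | <ᵇ-false (<⇒≤ y<z) | <ᵇ-false (<⇒≤ (<-trans x<y y<z))
          | n<ᵇn x | n<ᵇn y | n<ᵇn z = _

orderIso-321 : ∀ {x y z} → T (orderIso (x ∷ y ∷ z ∷ []) p321) ⇔ (y < x × z < y)
orderIso-321 {x} {y} {z} = mk⇔ to′ from′
  where
  to′ : T (orderIso (x ∷ y ∷ z ∷ []) p321) → y < x × z < y
  to′ t with x <ᵇ x | n<ᵇn x | x <ᵇ y | x <ᵇ z | y <ᵇ x in y<x
           | y <ᵇ y | n<ᵇn y | y <ᵇ z | z <ᵇ x | z <ᵇ y in z<y
  ... | _ | refl | false | false | true | _ | refl | false | true | true =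
    <ᵇ⇒< y x (subst T (sym y<x) _) , <ᵇ⇒< z y (subst T (sym z<y) _)
  from′ : y < x × z < y → T (orderIso (x ∷ y ∷ z ∷ []) p321)
  from′ (y<x , z<y)
    rewrite <ᵇ-true y<x | <ᵇ-true z<y | <ᵇ-true (<-trans z<y y<x)
          | <ᵇ-false (<⇒≤ y<x) | <ᵇ-false (<⇒≤ z<y) | <ᵇ-false (<⇒≤ (<-trans z<y y<x))
          | n<ᵇn x | n<ᵇn y | n<ᵇn z = _

sort-increasing : ∀ {x y z} → x < y → y < z → sort (x ∷ y ∷ z ∷ []) ≡ x ∷ y ∷ z ∷ []
sort-increasing {x} {y} {z} x<y y<z
  rewrite dec-true (y ≤? z) (<⇒≤ y<z) | dec-true (x ≤? y) (<⇒≤ x<y) = refl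

sort-decreasing : ∀ {x y z} → y < x → z < y → sort (x ∷ y ∷ z ∷ []) ≡ z ∷ y ∷ x ∷ []
sort-decreasing {x} {y} {z} y<x z<y
  rewrite dec-false (y ≤? z) (<⇒≱ z<y) | dec-false (x ≤? z) (<⇒≱ (<-trans z<y y<x))
        | dec-false (x ≤? y) (<⇒≱ y<x) = refl

-- isOccurrence of Defs, unfolded, with the length n of the word as a parameter: the image of
-- a word under a symmetry has length n only propositionally.
rectEmpty : List ℕ → ℕ → (x₀ x₁ y₀ y₁ : ℕ) → Bool
rectEmpty π n x₀ x₁ y₀ y₁ =
  not (anyB (λ m → (x₀ <ᵇ m) ∧ (m <ᵇ x₁) ∧ (y₀ <ᵇ at π (m ∸ 1)) ∧ (at π (m ∸ 1) <ᵇ y₁)) (oneTo n))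

boxEmpty : List ℕ → ℕ → (columns rows : List ℕ) → ℕ × ℕ → Bool
boxEmpty π n cols rows (a , b) = rectEmpty π n (at cols a) (at cols (suc a)) (at rows b) (at rows (suc b))

grid : ℕ → List ℕ → List ℕ
grid n l = 0 ∷ (l ++ (suc n ∷ []))

occursAt : MeshPattern → List ℕ → ℕ → (is vs : List ℕ) → Bool
occursAt p π n is vs = orderIso vs (τ p) ∧ allB (boxEmpty π n (grid n is) (grid n (sort vs))) (R p)

occOfLength : MeshPattern → List ℕ → ℕ → ℕ
occOfLength p π n = count (λ is → occursAt p π n is (valuesAt π is)) (choose (length (τ p)) (oneTo n))

occ≡occOfLength : ∀ p π → length π ≡ n → occ p π ≡ occOfLength p π n
occ≡occOfLength p π refl = refl

-- Complement

complement : ℕ → List ℕ → List ℕ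
complement n = map (mirror n)

valuesAt-complement : ∀ {π is} → length π ≡ n → All (_∈ oneTo n) is →
                      valuesAt (complement n π) is ≡ map (mirror n) (valuesAt π is)
valuesAt-complement {n} {π} length≡ is⊆ =
  trans (map-cong-local (All.map (at-map (mirror n) {π} ∘ at-index< {π = π} length≡) is⊆)) (map-∘ _)

rectEmpty-complement : ∀ {π x₀ x₁ y₀ y₁} → IsPermutation n π → y₀ ≤ suc n → y₁ ≤ suc n →
  rectEmpty (complement n π) n x₀ x₁ (mirror n y₀) (mirror n y₁) ≡ rectEmpty π n x₀ x₁ y₁ y₀
rectEmpty-complement {n} {π} {x₀} {x₁} {y₀} {y₁} perm y₀≤ y₁≤ =
  cong not (anyB-cong (λ {m} m∈ → cong (λ u → (x₀ <ᵇ m) ∧ (m <ᵇ x₁) ∧ u) (inRows m∈)))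
  where
  inRows : ∀ {m} → m ∈ oneTo n →
    (mirror n y₀ <ᵇ at (complement n π) (m ∸ 1)) ∧ (at (complement n π) (m ∸ 1) <ᵇ mirror n y₁)
    ≡ (y₁ <ᵇ at π (m ∸ 1)) ∧ (at π (m ∸ 1) <ᵇ y₀)
  inRows {m} m∈ = begin
    (mirror n y₀ <ᵇ at (complement n π) (m ∸ 1)) ∧ (at (complement n π) (m ∸ 1) <ᵇ mirror n y₁)
      ≡⟨ cong (λ w → (mirror n y₀ <ᵇ w) ∧ (w <ᵇ mirror n y₁))
              (at-map (mirror n) {π} (at-index< {π = π} (length≡ perm) m∈)) ⟩
    (mirror n y₀ <ᵇ mirror n v) ∧ (mirror n v <ᵇ mirror n y₁)
      ≡⟨ cong₂ _∧_ (mirror-<ᵇ y₀≤) (mirror-<ᵇ (∈-oneTo⇒≤suc (at-entry perm m∈))) ⟩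
    (v <ᵇ y₀) ∧ (y₁ <ᵇ v)
      ≡⟨ ∧-comm (v <ᵇ y₀) (y₁ <ᵇ v) ⟩
    (y₁ <ᵇ v) ∧ (v <ᵇ y₀)
      ∎
    where
    open ≡-Reasoning
    v = at π (m ∸ 1)

complementBox : ℕ × ℕ → ℕ × ℕ
complementBox (a , b) = a , 3 ∸ b

ComplementInvariant : List (ℕ × ℕ) → Set
ComplementInvariant R = All (λ r → proj₂ r ≤ 3 × complementBox r ∈ R) R

complementBox-involution : ∀ {R} → ComplementInvariant R → InvolutionOn complementBox R
complementBox-involution inv = record
  { closed     = proj₂ ∘ All.lookup inv
  ; involutive = cong (_ ,_) ∘ m∸[m∸n]≡n ∘ proj₁ ∘ All.lookup inv
  }

boxEmpty-complement : ∀ {π x y z} → IsPermutation n π → x ≤ suc n → y ≤ suc n → z ≤ suc n →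
  ∀ cols {r} → proj₂ r ≤ 3 →
  boxEmpty (complement n π) n cols (0 ∷ mirror n x ∷ mirror n y ∷ mirror n z ∷ suc n ∷ []) r
  ≡ boxEmpty π n cols (0 ∷ z ∷ y ∷ x ∷ suc n ∷ []) (complementBox r)
boxEmpty-complement {n} {π} {x} perm x≤ y≤ z≤ cols {a , 0} _ =
  trans (cong (λ w → rectEmpty (complement n π) n (at cols a) (at cols (suc a)) w (mirror n x)) (sym (n∸n≡0 n)))
        (rectEmpty-complement {x₀ = at cols a} {at cols (suc a)} perm ≤-refl x≤)
boxEmpty-complement perm x≤ y≤ z≤ cols {a , 1} _ =
  rectEmpty-complement {x₀ = at cols a} {at cols (suc a)} perm x≤ y≤
boxEmpty-complement perm x≤ y≤ z≤ cols {a , 2} _ =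
  rectEmpty-complement {x₀ = at cols a} {at cols (suc a)} perm y≤ z≤
boxEmpty-complement perm x≤ y≤ z≤ cols {a , 3} _ =
  rectEmpty-complement {x₀ = at cols a} {at cols (suc a)} perm z≤ z≤n
boxEmpty-complement _ _ _ _ _ {_ , suc (suc (suc (suc _)))} (s≤s (s≤s (s≤s ())))

occursAt-complement : ∀ {R π is x y z} → IsPermutation n π → ComplementInvariant R →
  x ≤ suc n → y ≤ suc n → z ≤ suc n →
  occursAt (mesh p123 R) (complement n π) n is (map (mirror n) (x ∷ y ∷ z ∷ []))
  ≡ occursAt (mesh p321 R) π n is (x ∷ y ∷ z ∷ [])
occursAt-complement {n} {R} {π} {is} {x} {y} {z} perm inv x≤ y≤ z≤ =
  ∧-cong-guarded
    (T-injective (⇔.trans orderIso-123 (⇔.trans mirrored (⇔.sym (orderIso-321 {x} {y} {z})))))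
    boxes
  where
  mirrored : (mirror n x < mirror n y × mirror n y < mirror n z) ⇔ (y < x × z < y)
  mirrored = N∸m<N∸n⇔n<m x≤ ×-⇔ N∸m<N∸n⇔n<m y≤
  cols = grid n is
  boxes : T (orderIso (x ∷ y ∷ z ∷ []) p321) →
    allB (boxEmpty (complement n π) n cols (grid n (sort (map (mirror n) (x ∷ y ∷ z ∷ []))))) R
    ≡ allB (boxEmpty π n cols (grid n (sort (x ∷ y ∷ z ∷ [])))) R
  boxes t = begin
    allB (boxEmpty (complement n π) n cols (grid n (sort (map (mirror n) (x ∷ y ∷ z ∷ []))))) R
      ≡⟨ cong (λ s → allB (boxEmpty (complement n π) n cols (grid n s)) R)
              (sort-increasing (proj₁ increasing) (proj₂ increasing)) ⟩
    allB (boxEmpty (complement n π) n cols (0 ∷ mirror n x ∷ mirror n y ∷ mirror n z ∷ suc n ∷ [])) R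
      ≡⟨ allB-cong (λ r∈ → boxEmpty-complement perm x≤ y≤ z≤ cols (proj₁ (All.lookup inv r∈))) ⟩
    allB (boxEmpty π n cols (0 ∷ z ∷ y ∷ x ∷ suc n ∷ []) ∘ complementBox) R
      ≡⟨ allB-reindex (complementBox-involution inv) ⟨
    allB (boxEmpty π n cols (0 ∷ z ∷ y ∷ x ∷ suc n ∷ [])) R
      ≡⟨ cong (λ s → allB (boxEmpty π n cols (grid n s)) R) (sort-decreasing y<x z<y) ⟨
    allB (boxEmpty π n cols (grid n (sort (x ∷ y ∷ z ∷ [])))) R
      ∎
    where
    open ≡-Reasoning
    y<x = proj₁ (to (orderIso-321 {x} {y} {z}) t)
    z<y = proj₂ (to (orderIso-321 {x} {y} {z}) t)
    increasing = from mirrored (y<x , z<y)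

occOfLength-complement : ∀ {R π} → IsPermutation n π → ComplementInvariant R →
  occOfLength (mesh p123 R) (complement n π) n ≡ occOfLength (mesh p321 R) π n
occOfLength-complement {n} {R} {π} perm inv = count-cong pointwise
  where
  bound : ∀ {i} → i ∈ oneTo n → at π (i ∸ 1) ≤ suc n
  bound = ∈-oneTo⇒≤suc ∘ at-entry perm
  pointwise : ∀ {is} → is ∈ choose 3 (oneTo n) →
    occursAt (mesh p123 R) (complement n π) n is (valuesAt (complement n π) is)
    ≡ occursAt (mesh p321 R) π n is (valuesAt π is)
  pointwise is∈ with ∈-choose⁻ 3 {oneTo n} is∈
  pointwise {i ∷ j ∷ k ∷ []} _ | refl , is⊆@(i∈ ∷ j∈ ∷ k∈ ∷ []) =
    trans (cong (occursAt (mesh p123 R) (complement n π) n (i ∷ j ∷ k ∷ []))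
                (valuesAt-complement {π = π} (length≡ perm) is⊆))
          (occursAt-complement {is = i ∷ j ∷ k ∷ []} perm inv (bound i∈) (bound j∈) (bound k∈))

occ-complement : ∀ {R π} → ComplementInvariant R → π ∈ Sn n →
  occ (mesh p123 R) (complement n π) ≡ occ (mesh p321 R) π
occ-complement {n} {R} {π} inv π∈ = begin
  occ (mesh p123 R) (complement n π)
    ≡⟨ occ≡occOfLength (mesh p123 R) (complement n π) (length≡ (IsPermutation-map (mirror-involution n) perm)) ⟩
  occOfLength (mesh p123 R) (complement n π) n
    ≡⟨ occOfLength-complement perm inv ⟩
  occOfLength (mesh p321 R) π n
    ≡⟨ occ≡occOfLength (mesh p321 R) π (length≡ perm) ⟨
  occ (mesh p321 R) π
    ∎
  where
  open ≡-Reasoning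
  perm = to (∈-Sn⇔IsPermutation n) π∈

complementSwap : ∀ {R} → ComplementInvariant R → ∀ n → OccurrenceSwap (mesh p123 R) (mesh p321 R) n
complementSwap inv n = record
  { symmetry   = complement n
  ; involution = map-involution-Sn (mirror-involution n)
  ; exchanges  = occ-complement {n} inv
  }

-- Reverse

valuesAt-reverse : ∀ {π is} → length π ≡ n → All (_∈ oneTo n) is →
                   valuesAt (reverse π) (reverse (map (mirror n) is)) ≡ reverse (valuesAt π is)
valuesAt-reverse {n} {π} {is} length≡ is⊆ = begin
  map (λ i → at (reverse π) (i ∸ 1)) (reverse (map (mirror n) is))
    ≡⟨ reverse-map _ (map (mirror n) is) ⟩
  reverse (map (λ i → at (reverse π) (i ∸ 1)) (map (mirror n) is))
    ≡⟨ cong reverse (map-∘ is) ⟨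
  reverse (map (λ i → at (reverse π) (mirror n i ∸ 1)) is)
    ≡⟨ cong reverse (map-cong-local (All.map (at-reverse-mirror {π = π} length≡) is⊆)) ⟩
  reverse (valuesAt π is)
    ∎
  where open ≡-Reasoning

rectEmpty-reverse : ∀ {π x₀ x₁ y₀ y₁} → length π ≡ n → x₀ ≤ suc n → x₁ ≤ suc n →
  rectEmpty (reverse π) n (mirror n x₁) (mirror n x₀) y₀ y₁ ≡ rectEmpty π n x₀ x₁ y₀ y₁
rectEmpty-reverse {n} {π} {x₀} {x₁} {y₀} {y₁} length≡ x₀≤ x₁≤ =
  cong not (trans (anyB-reindex (mirror-involution n)) (anyB-cong pointwise))
  where
  pointwise : ∀ {m} → m ∈ oneTo n →
    (mirror n x₁ <ᵇ mirror n m) ∧ (mirror n m <ᵇ mirror n x₀)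
      ∧ (y₀ <ᵇ at (reverse π) (mirror n m ∸ 1)) ∧ (at (reverse π) (mirror n m ∸ 1) <ᵇ y₁)
    ≡ (x₀ <ᵇ m) ∧ (m <ᵇ x₁) ∧ (y₀ <ᵇ at π (m ∸ 1)) ∧ (at π (m ∸ 1) <ᵇ y₁)
  pointwise {m} m∈ = begin
    (mirror n x₁ <ᵇ mirror n m) ∧ (mirror n m <ᵇ mirror n x₀)
      ∧ (y₀ <ᵇ at (reverse π) (mirror n m ∸ 1)) ∧ (at (reverse π) (mirror n m ∸ 1) <ᵇ y₁)
      ≡⟨ cong (λ w → (mirror n x₁ <ᵇ mirror n m) ∧ (mirror n m <ᵇ mirror n x₀) ∧ (y₀ <ᵇ w) ∧ (w <ᵇ y₁))
              (at-reverse-mirror {π = π} length≡ m∈) ⟩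
    (mirror n x₁ <ᵇ mirror n m) ∧ (mirror n m <ᵇ mirror n x₀) ∧ inRows
      ≡⟨ cong₂ (λ u w → u ∧ w ∧ inRows) (mirror-<ᵇ x₁≤) (mirror-<ᵇ (∈-oneTo⇒≤suc m∈)) ⟩
    (m <ᵇ x₁) ∧ (x₀ <ᵇ m) ∧ inRows
      ≡⟨ x∙yz≈y∙xz (m <ᵇ x₁) (x₀ <ᵇ m) inRows ⟩
    (x₀ <ᵇ m) ∧ (m <ᵇ x₁) ∧ inRows
      ∎
    where
    open ≡-Reasoning
    inRows = (y₀ <ᵇ at π (m ∸ 1)) ∧ (at π (m ∸ 1) <ᵇ y₁)

reverseBox : ℕ × ℕ → ℕ × ℕ
reverseBox (a , b) = 3 ∸ a , b

ReverseInvariant : List (ℕ × ℕ) → Set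
ReverseInvariant R = All (λ r → proj₁ r ≤ 3 × reverseBox r ∈ R) R

reverseBox-involution : ∀ {R} → ReverseInvariant R → InvolutionOn reverseBox R
reverseBox-involution inv = record
  { closed     = proj₂ ∘ All.lookup inv
  ; involutive = cong (_, _) ∘ m∸[m∸n]≡n ∘ proj₁ ∘ All.lookup inv
  }

boxEmpty-reverse : ∀ {π i j k} → length π ≡ n → i ≤ suc n → j ≤ suc n → k ≤ suc n →
  ∀ rows {r} → proj₁ r ≤ 3 →
  boxEmpty (reverse π) n (0 ∷ mirror n k ∷ mirror n j ∷ mirror n i ∷ suc n ∷ []) rows r
  ≡ boxEmpty π n (0 ∷ i ∷ j ∷ k ∷ suc n ∷ []) rows (reverseBox r)
boxEmpty-reverse {n} {π} {k = k} length≡ i≤ j≤ k≤ rows {0 , b} _ =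
  trans (cong (λ w → rectEmpty (reverse π) n w (mirror n k) (at rows b) (at rows (suc b))) (sym (n∸n≡0 n)))
        (rectEmpty-reverse {π = π} {y₀ = at rows b} {at rows (suc b)} length≡ k≤ ≤-refl)
boxEmpty-reverse {π = π} length≡ i≤ j≤ k≤ rows {1 , b} _ =
  rectEmpty-reverse {π = π} {y₀ = at rows b} {at rows (suc b)} length≡ j≤ k≤
boxEmpty-reverse {π = π} length≡ i≤ j≤ k≤ rows {2 , b} _ =
  rectEmpty-reverse {π = π} {y₀ = at rows b} {at rows (suc b)} length≡ i≤ j≤
boxEmpty-reverse {π = π} length≡ i≤ j≤ k≤ rows {3 , b} _ =
  rectEmpty-reverse {π = π} {y₀ = at rows b} {at rows (suc b)} length≡ z≤n i≤
boxEmpty-reverse _ _ _ _ _ {suc (suc (suc (suc _))) , _} (s≤s (s≤s (s≤s ())))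

occursAt-reverse : ∀ {R π i j k x y z} → length π ≡ n → ReverseInvariant R →
  i ≤ suc n → j ≤ suc n → k ≤ suc n →
  occursAt (mesh p123 R) (reverse π) n (mirror n k ∷ mirror n j ∷ mirror n i ∷ []) (z ∷ y ∷ x ∷ [])
  ≡ occursAt (mesh p321 R) π n (i ∷ j ∷ k ∷ []) (x ∷ y ∷ z ∷ [])
occursAt-reverse {n} {R} {π} {i} {j} {k} {x} {y} {z} length≡ inv i≤ j≤ k≤ =
  ∧-cong-guarded
    (T-injective (⇔.trans orderIso-123 (⇔.trans (mk⇔ swap swap) (⇔.sym (orderIso-321 {x} {y} {z})))))
    boxes
  where
  cols′ = grid n (mirror n k ∷ mirror n j ∷ mirror n i ∷ [])
  cols  = grid n (i ∷ j ∷ k ∷ [])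
  rows  = grid n (z ∷ y ∷ x ∷ [])
  boxes : T (orderIso (x ∷ y ∷ z ∷ []) p321) →
    allB (boxEmpty (reverse π) n cols′ (grid n (sort (z ∷ y ∷ x ∷ [])))) R
    ≡ allB (boxEmpty π n cols (grid n (sort (x ∷ y ∷ z ∷ [])))) R
  boxes t = begin
    allB (boxEmpty (reverse π) n cols′ (grid n (sort (z ∷ y ∷ x ∷ [])))) R
      ≡⟨ cong (λ s → allB (boxEmpty (reverse π) n cols′ (grid n s)) R) (sort-increasing z<y y<x) ⟩
    allB (boxEmpty (reverse π) n cols′ rows) R
      ≡⟨ allB-cong (λ {r} r∈ → boxEmpty-reverse {π = π} length≡ i≤ j≤ k≤ rows {r} (proj₁ (All.lookup inv r∈))) ⟩
    allB (boxEmpty π n cols rows ∘ reverseBox) R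
      ≡⟨ allB-reindex (reverseBox-involution inv) ⟨
    allB (boxEmpty π n cols rows) R
      ≡⟨ cong (λ s → allB (boxEmpty π n cols (grid n s)) R) (sort-decreasing y<x z<y) ⟨
    allB (boxEmpty π n cols (grid n (sort (x ∷ y ∷ z ∷ [])))) R
      ∎
    where
    open ≡-Reasoning
    y<x = proj₁ (to (orderIso-321 {x} {y} {z}) t)
    z<y = proj₂ (to (orderIso-321 {x} {y} {z}) t)

occOfLength-reverse : ∀ {R π} → length π ≡ n → ReverseInvariant R →
  occOfLength (mesh p123 R) (reverse π) n ≡ occOfLength (mesh p321 R) π n
occOfLength-reverse {n} {R} {π} length≡ inv = begin
  count P′ triples                  ≡⟨ count-↭ (choose-oneTo-mirror 3 n) ⟨
  count P′ (map mirrored triples)   ≡⟨ count-map mirrored triples ⟩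
  count (P′ ∘ mirrored) triples     ≡⟨ count-cong pointwise ⟩
  count P triples                   ∎
  where
  open ≡-Reasoning
  triples = choose 3 (oneTo n)
  mirrored = reverse ∘ map (mirror n)
  P′ = λ is → occursAt (mesh p123 R) (reverse π) n is (valuesAt (reverse π) is)
  P  = λ is → occursAt (mesh p321 R) π n is (valuesAt π is)
  pointwise : ∀ {is} → is ∈ triples → P′ (mirrored is) ≡ P is
  pointwise is∈ with ∈-choose⁻ 3 {oneTo n} is∈
  pointwise {i ∷ j ∷ k ∷ []} _ | refl , is⊆@(i∈ ∷ j∈ ∷ k∈ ∷ []) =
    trans (cong (occursAt (mesh p123 R) (reverse π) n (mirrored (i ∷ j ∷ k ∷ [])))
                (valuesAt-reverse {π = π} length≡ is⊆))
          (occursAt-reverse {π = π} {x = at π (i ∸ 1)} {at π (j ∸ 1)} {at π (k ∸ 1)} length≡ inv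
                            (∈-oneTo⇒≤suc i∈) (∈-oneTo⇒≤suc j∈) (∈-oneTo⇒≤suc k∈))

occ-reverse : ∀ {R π} → ReverseInvariant R → π ∈ Sn n → occ (mesh p123 R) (reverse π) ≡ occ (mesh p321 R) π
occ-reverse {n} {R} {π} inv π∈ = begin
  occ (mesh p123 R) (reverse π)
    ≡⟨ occ≡occOfLength (mesh p123 R) (reverse π) (length≡ (IsPermutation-reverse perm)) ⟩
  occOfLength (mesh p123 R) (reverse π) n
    ≡⟨ occOfLength-reverse {π = π} (length≡ perm) inv ⟩
  occOfLength (mesh p321 R) π n
    ≡⟨ occ≡occOfLength (mesh p321 R) π (length≡ perm) ⟨
  occ (mesh p321 R) π
    ∎
  where
  open ≡-Reasoning
  perm = to (∈-Sn⇔IsPermutation n) π∈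

reverseSwap : ∀ {R} → ReverseInvariant R → ∀ n → OccurrenceSwap (mesh p123 R) (mesh p321 R) n
reverseSwap inv n = record
  { symmetry   = reverse
  ; involution = reverse-involution-Sn n
  ; exchanges  = occ-reverse {n} inv
  }

complementInvariant? : ∀ R → Dec (ComplementInvariant R)
complementInvariant? R = All.all? (λ r → (proj₂ r ≤? 3) ×-dec (complementBox r ∈? R)) R

reverseInvariant? : ∀ R → Dec (ReverseInvariant R)
reverseInvariant? R = All.all? (λ r → (proj₁ r ≤? 3) ×-dec (reverseBox r ∈? R)) R

shadings-invariant : All (λ R → ComplementInvariant R ⊎ ReverseInvariant R) shadings
shadings-invariant =
  toWitness {a? = All.all? (λ R → complementInvariant? R ⊎-dec reverseInvariant? R) shadings} _

mainTheorem5 : (R : List (ℕ × ℕ)) → R ∈ shadings →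
    JointlyEquidistributed (mesh p123 R) (mesh p321 R)
mainTheorem5 R R∈ =
  [ jointlyEquidistributed ∘ complementSwap , jointlyEquidistributed ∘ reverseSwap ]
    (All.lookup shadings-invariant R∈)
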